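{- Let $\Gamma$ and $\Sigma$ be connected graphs such that $\Gamma$ is non-bipartite and $\Sigma$ is bipartite with bipartition $\{U,W\}$, and let $\rho$ be an automorphism of $S(\Gamma)\Box S(\Sigma)$ that stabilizes $V(\Gamma)\times U$ and is a $\Sigma$-mixer of $V(\Gamma)\times V(\Sigma)$. Then $\rho$ is a $\Gamma$-mixer of $V(\Gamma)\times V(\Sigma)$.
   Context: All graphs are finite, undirected, without multiple edges, but possibly with loops. The Cartesian product $\Gamma\Box\Sigma$ has vertex set $V(\Gamma)\times V(\Sigma)$, with $(u,i)\sim(v,j)$ iff either $u=v$ and $i\sim j$ in $\Sigma$, or $i=j$ and $u\sim v$ in $\Gamma$. For sets $A,B$, the $A$-partition of $A\times B$ is $\{\{a\}\times B:a\in A\}$ and the $B$-partition is $\{A\times\{b\}:b\in B\}$; a permutation of $A\times B$ is an $A$-mixer (resp. $B$-mixer) if it does not preserve (i.e. does not permute the blocks of) the $A$-partition (resp. $B$-partition). A $\Gamma$-mixer (resp. $\Sigma$-mixer) of $V(\Gamma)\times V(\Sigma)$ means a $V(\Gamma)$-mixer (resp. $V(\Sigma)$-mixer). For a graph $\Gamma$, $B(\Gamma)$ is the graph on $V(\Gamma)$ whose edges are the pairs $\{u,v\}$ with $u\neq v$ and $N_\Gamma(u)\cap N_\Gamma(v)\neq\emptyset$. An edge $\{u,v\}$ of $B(\Gamma)$ is dispensable if there exists $w\in V(\Gamma)$ such that both (i) $N_\Gamma(u)\cap N_\Gamma(v)\subsetneq N_\Gamma(u)\cap N_\Gamma(w)$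 or $N_\Gamma(u)\subsetneq N_\Gamma(w)\subsetneq N_\Gamma(v)$, and (ii) $N_\Gamma(v)\cap N_\Gamma(u)\subsetneq N_\Gamma(v)\cap N_\Gamma(w)$ or $N_\Gamma(v)\subsetneq N_\Gamma(w)\subsetneq N_\Gamma(u)$. The Cartesian skeleton $S(\Gamma)$ is obtained from $B(\Gamma)$ by deleting all dispensable edges. -}

module Defs where

open import Data.Nat using (ℕ; _<_)
open import Data.Fin using (Fin)
open import Data.Bool using (Bool; T)
open import Data.Product using (_×_; _,_; proj₁; proj₂; ∃; ∃-syntax)
open import Data.Sum using (_⊎_)
open import Relation.Nullary using (¬_)
open import Relation.Unary using (Pred; _⊂_; _∩_)
open import Relation.Binary.PropositionalEquality using (_≡_; _≢_)
open import Relation.Binary.Construct.Closure.ReflexiveTransitive using (Star)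
open import Function.Bundles using (_↔_; Inverse)

-- A finite undirected graph (loops allowed, no multiple edges) on vertex set Fin n,
-- given by a symmetric Boolean adjacency matrix.
record Graph (n : ℕ) : Set where
  field
    adj : Fin n → Fin n → Bool
    adj-sym : ∀ u v → adj u v ≡ adj v u

module _ {n : ℕ} (G : Graph n) where
  open Graph G

  Adj : Fin n → Fin n → Set
  Adj u v = T (adj u v)

  N : Fin n → Pred (Fin n) _
  N u v = Adj u v

  Connected : Set
  Connected = (0 < n) × (∀ u v → Star Adj u v)

  -- U : V → Bool is the indicator of one part; the other part is its complement.
  IsBipartition : (Fin n → Bool) → Set
  IsBipartition U = ∀ u v → Adj u v → U u ≢ U v

  Bipartite : Set
  Bipartite = ∃[ U ] IsBipartition U

  BAdj : Fin n → Fin n → Set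
  BAdj u v = (u ≢ v) × (∃[ x ] (Adj u x × Adj v x))

  Dispensable : Fin n → Fin n → Set
  Dispensable u v = ∃[ w ]
    ( ((N u ∩ N v) ⊂ (N u ∩ N w) ⊎ (N u ⊂ N w × N w ⊂ N v))
    × ((N v ∩ N u) ⊂ (N v ∩ N w) ⊎ (N v ⊂ N w × N w ⊂ N u)) )

  SAdj : Fin n → Fin n → Set
  SAdj u v = BAdj u v × ¬ Dispensable u v

_□_ : {A B : Set} → (A → A → Set) → (B → B → Set) → (A × B → A × B → Set)
(R □ S) (u , i) (v , j) = (u ≡ v × S i j) ⊎ (i ≡ j × R u v)

IsAut : {X : Set} → (X → X → Set) → X ↔ X → Set
IsAut R ρ = ∀ x y → (R x y → R (Inverse.to ρ x) (Inverse.to ρ y)) × (R (Inverse.to ρ x) (Inverse.to ρ y) → R x y)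

Stabilizes : {X : Set} → X ↔ X → Pred X _ → Set
Stabilizes ρ P = ∀ x → (P x → P (Inverse.to ρ x)) × (P (Inverse.to ρ x) → P x)

PreservesFst : {A B : Set} → (A × B) ↔ (A × B) → Set
PreservesFst ρ = ∀ a → ∃[ a' ] ∀ x →
  (proj₁ x ≡ a → proj₁ (Inverse.to ρ x) ≡ a') × (proj₁ (Inverse.to ρ x) ≡ a' → proj₁ x ≡ a)

PreservesSnd : {A B : Set} → (A × B) ↔ (A × B) → Set
PreservesSnd ρ = ∀ b → ∃[ b' ] ∀ x →
  (proj₂ x ≡ b → proj₂ (Inverse.to ρ x) ≡ b') × (proj₂ (Inverse.to ρ x) ≡ b' → proj₂ x ≡ b)

FstMixer : {A B : Set} → (A × B) ↔ (A × B) → Set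
FstMixer ρ = ¬ PreservesFst ρ

SndMixer : {A B : Set} → (A × B) ↔ (A × B) → Set
SndMixer ρ = ¬ PreservesSnd ρ

-- If ρ preserved the Γ-partition, it would send an edge (a , i) ∼ (b , i) with a ∼ b in S(Γ)
-- to an edge joining two different Σ-fibres, hence to one with equal second coordinates.  For
-- Γ connected and non-bipartite the skeleton S(Γ) is connected, so the second coordinate of
-- ρ (a , i) would not depend on a, and ρ would preserve the Σ-partition too.
-- S(Γ) is connected because any two vertices are joined by an even walk, whose two-steps are
-- edges of B(Γ) or loops, and a dispensable edge u v of B(Γ) with witness w can be replaced by
-- the edges u w and w v of B(Γ), each smaller in a well-founded order on pairs.
module Submission where

open import Defs
open import Level using (0ℓ)
open import Data.Nat using (ℕ)
open import Data.Bool using (Bool; true; false; not; _xor_; T)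
open import Data.Bool.Properties
  using (T-≡; not-involutive; not-distribˡ-xor; xor-comm; xor-assoc; xor-same)
open import Data.Fin using (Fin; fromℕ<)
open import Data.Fin.Properties using (_≟_; ¬∀⟶∃¬)
open import Data.Fin.Subset using (Subset; _∈_; _∉_)
  renaming (_∩_ to _∩ˢ_; _∪_ to _∪ˢ_; _⊆_ to _⊆ˢ_; _⊂_ to _⊂ˢ_; _⊃_ to _⊃ˢ_)
open import Data.Fin.Subset.Properties
  using (_∈?_; x∈p∩q⁺; x∈p∩q⁻; x∈p∪q⁺; x∈p∪q⁻; ∩-comm; ∪-comm; ⊆-antisym)
open import Data.Fin.Subset.Induction using (⊂-wellFounded; ⊃-wellFounded)
open import Data.Vec using (tabulate)
open import Data.Vec.Properties using (lookup∘tabulate; []=⇒lookup; lookup⇒[]=)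
open import Data.Product using (_×_; _,_; proj₁; proj₂; ∃-syntax)
open import Data.Product.Properties using (×-≡,≡→≡)
open import Data.Product.Relation.Binary.Lex.Strict using (×-Lex; ×-wellFounded)
open import Data.Sum using (_⊎_; inj₁; inj₂; [_,_]) renaming (map to ⊎-map)
open import Effect.Monad using (RawMonad)
open import Function.Base using (id; _∘_; _on_)
open import Function.Bundles using (_↔_; Inverse; Injection; _⇔_; mk⇔; Equivalence)
open import Function.Properties.Inverse using (↔⇒↣)
open import Induction.WellFounded using (Acc; acc; WellFounded)
import Relation.Binary.Construct.On as On
open import Relation.Binary.Construct.Closure.ReflexiveTransitive using (Star; ε; _◅_; _◅◅_)
open import Relation.Binary.PropositionalEquality
  using (_≡_; _≢_; refl; sym; trans; cong; cong₂; subst; subst₂; ≢-sym; module ≡-Reasoning)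
open import Relation.Nullary using (¬_; yes; no)
open import Relation.Nullary.Decidable using (decidable-stable; ¬¬-excluded-middle; _→-dec_)
open import Relation.Nullary.Negation using (¬¬-Monad; ¬¬-map; contradiction)
open import Relation.Unary using (Pred; _⊆_; _⊂_; _∩_; _∪_)

open RawMonad (¬¬-Monad {0ℓ}) using (pure; _>>=_)

Represents : {n : ℕ} → Subset n → Pred (Fin n) 0ℓ → Set
Represents p P = ∀ {x} → x ∈ p ⇔ P x

module _ {n : ℕ} {p q : Subset n} {P Q : Pred (Fin n) 0ℓ}
         (p≈P : Represents p P) (q≈Q : Represents q Q) where
  open Equivalence

  ∩-represents : Represents (p ∩ˢ q) (P ∩ Q)
  ∩-represents = mk⇔
    (λ x∈p∩q → let (x∈p , x∈q) = x∈p∩q⁻ p q x∈p∩q in to p≈P x∈p , to q≈Q x∈q)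
    (λ (Px , Qx) → x∈p∩q⁺ (from p≈P Px , from q≈Q Qx))

  ∪-represents : Represents (p ∪ˢ q) (P ∪ Q)
  ∪-represents = mk⇔
    (λ x∈p∪q → ⊎-map (to p≈P) (to q≈Q) (x∈p∪q⁻ p q x∈p∪q))
    (λ PQx → x∈p∪q⁺ (⊎-map (from p≈P) (from q≈Q) PQx))

  ⊆-represents : P ⊆ Q → p ⊆ˢ q
  ⊆-represents P⊆Q x∈p = from q≈Q (P⊆Q (to p≈P x∈p))

  ⊂-represents : P ⊂ Q → p ⊂ˢ q
  ⊂-represents (P⊆Q , Q⊈P) =
    let (x , x∈q⇏x∈p) = ¬∀⟶∃¬ n (λ x → x ∈ q → x ∈ p) (λ x → x ∈? q →-dec x ∈? p) q⊈p
    in ⊆-represents P⊆Q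
     , x
     , decidable-stable (x ∈? q) (λ x∉q → x∈q⇏x∈p (λ x∈q → contradiction x∈q x∉q))
     , (λ x∈p → x∈q⇏x∈p (λ _ → x∈p))
    where
    q⊈p : ¬ (∀ x → x ∈ q → x ∈ p)
    q⊈p q⊆p = Q⊈P (λ Qx → to p≈P (q⊆p _ (from q≈Q Qx)))

module _ {n : ℕ} (Γ : Graph n) where
  open Graph Γ using (adj; adj-sym)

  Adj-sym : ∀ {u v} → Adj Γ u v → Adj Γ v u
  Adj-sym {u} {v} = subst T (adj-sym u v)

  nbhd : Fin n → Subset n
  nbhd u = tabulate (adj u)

  nbhd-represents : ∀ u → Represents (nbhd u) (N Γ u)
  nbhd-represents u {x} = mk⇔
    (λ x∈ → Equivalence.from T-≡ (trans (sym (lookup∘tabulate (adj u) x)) ([]=⇒lookup x∈)))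
    (λ ux → lookup⇒[]= x (nbhd u) (trans (lookup∘tabulate (adj u) x) (Equivalence.to T-≡ ux)))

  common-represents : ∀ u v → Represents (nbhd u ∩ˢ nbhd v) (N Γ u ∩ N Γ v)
  common-represents u v = ∩-represents (nbhd-represents u) (nbhd-represents v)

  joint-represents : ∀ u v → Represents (nbhd u ∪ˢ nbhd v) (N Γ u ∪ N Γ v)
  joint-represents u v = ∪-represents (nbhd-represents u) (nbhd-represents v)

  -- Dispensable Γ u v unfolds to ∃[ w ] (Closer u v w × Closer v u w).
  Closer : Fin n → Fin n → Fin n → Set
  Closer u v w = (N Γ u ∩ N Γ v) ⊂ (N Γ u ∩ N Γ w) ⊎ (N Γ u ⊂ N Γ w × N Γ w ⊂ N Γ v)

  closer-≢ : ∀ {u v w} → Closer u v w → v ≢ w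
  closer-≢ (inj₁ (_ , ⊉)) refl = ⊉ id
  closer-≢ (inj₂ (_ , _ , ⊉)) refl = ⊉ id

  closer-common : ∀ {u v w x} → Closer u v w → Adj Γ u x → Adj Γ v x → Adj Γ w x
  closer-common (inj₁ (⊆ , _)) ux vx = proj₂ (⊆ (ux , vx))
  closer-common (inj₂ ((⊆ , _) , _)) ux vx = ⊆ ux

  key : Fin n × Fin n → Subset n × Subset n
  key (u , v) = nbhd u ∩ˢ nbhd v , nbhd u ∪ˢ nbhd v

  key-comm : ∀ u v → key (u , v) ≡ key (v , u)
  key-comm u v = cong₂ _,_ (∩-comm (nbhd u) (nbhd v)) (∪-comm (nbhd u) (nbhd v))

  _≺_ : Fin n × Fin n → Fin n × Fin n → Set
  _≺_ = ×-Lex _≡_ _⊃ˢ_ _⊂ˢ_ on key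

  ≺-wellFounded : WellFounded _≺_
  ≺-wellFounded = On.wellFounded key (×-wellFounded ⊃-wellFounded ⊂-wellFounded)

  ≺-swap : ∀ {u v w} → (u , w) ≺ (u , v) → (w , u) ≺ (v , u)
  ≺-swap {u} {v} {w} = subst₂ (×-Lex _≡_ _⊃ˢ_ _⊂ˢ_) (key-comm u w) (key-comm u v)

  closer-≺ : ∀ {u v w} → Closer u v w → (u , w) ≺ (u , v)
  closer-≺ {u} {v} {w} (inj₁ uv⊂uw) =
    inj₁ (⊂-represents (common-represents u v) (common-represents u w) uv⊂uw)
  closer-≺ {u} {v} {w} (inj₂ ((u⊆w , _) , (w⊆v , v⊈w))) = inj₂ (same-common , smaller-joint)
    where
    -- As N u ⊆ N w ⊆ N v, both common neighbourhoods are N u, and the joint ones are N w ⊂ N v.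
    same-common : nbhd u ∩ˢ nbhd w ≡ nbhd u ∩ˢ nbhd v
    same-common = ⊆-antisym
      (⊆-represents (common-represents u w) (common-represents u v) (λ (ux , wx) → ux , w⊆v wx))
      (⊆-represents (common-represents u v) (common-represents u w) (λ (ux , _) → ux , u⊆w ux))
    smaller-joint : nbhd u ∪ˢ nbhd w ⊂ˢ nbhd u ∪ˢ nbhd v
    smaller-joint = ⊂-represents (joint-represents u w) (joint-represents u v)
      ( [ inj₁ , inj₂ ∘ w⊆v ]
      , λ uv⊆uw → v⊈w (λ vx → [ u⊆w , id ] (uv⊆uw (inj₂ vx))) )

  BAdj⇒skeleton-path : ∀ {u v} → BAdj Γ u v → ¬ ¬ Star (SAdj Γ) u v
  BAdj⇒skeleton-path = go (≺-wellFounded _)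
    where
    go : ∀ {u v} → Acc _≺_ (u , v) → BAdj Γ u v → ¬ ¬ Star (SAdj Γ) u v
    go {u} {v} (acc smaller) uv@(_ , x , ux , vx) = do
      yes (w , uvw , vuw) ← ¬¬-excluded-middle {A = Dispensable Γ u v}
        where no indispensable → pure ((uv , indispensable) ◅ ε)
      uw ← go (smaller (closer-≺ uvw)) (closer-≢ vuw , x , ux , closer-common uvw ux vx)
      wv ← go (smaller (≺-swap (closer-≺ vuw)))
              (≢-sym (closer-≢ uvw) , x , closer-common vuw vx ux , vx)
      pure (uw ◅◅ wv)

  common-neighbour⇒skeleton-path : ∀ {u v x} → Adj Γ u x → Adj Γ v x → ¬ ¬ Star (SAdj Γ) u v
  common-neighbour⇒skeleton-path {u} {v} ux vx with u ≟ v
  ... | yes refl = pure ε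
  ... | no u≢v = BAdj⇒skeleton-path (u≢v , _ , ux , vx)

  -- The tail's parity is written not b so that walks of known parity split by pattern matching.
  data Walk : Bool → Fin n → Fin n → Set where
    [] : ∀ {u} → Walk false u u
    _∷_ : ∀ {b u v w} → Adj Γ u v → Walk (not b) v w → Walk b u w

  cast : ∀ {a b u v} → a ≡ b → Walk a u v → Walk b u v
  cast refl p = p

  _++_ : ∀ {a b u v w} → Walk a u v → Walk b v w → Walk (a xor b) u w
  [] ++ q = q
  _++_ {a} {b} (e ∷ p) q = e ∷ cast (sym (not-distribˡ-xor a b)) (p ++ q)

  reverse : ∀ {b u v} → Walk b u v → Walk b v u
  reverse [] = []
  reverse {b} (e ∷ p) =
    cast (trans (xor-comm (not b) true) (not-involutive b)) (reverse p ++ (Adj-sym e ∷ []))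

  star⇒walk : ∀ {u v} → Star (Adj Γ) u v → ∃[ b ] Walk b u v
  star⇒walk ε = false , []
  star⇒walk (e ◅ s) with star⇒walk s
  ... | false , p = true , e ∷ p
  ... | true , p = false , e ∷ p

  even-walk⇒skeleton-path : ∀ {u v} → Walk false u v → ¬ ¬ Star (SAdj Γ) u v
  even-walk⇒skeleton-path [] = pure ε
  even-walk⇒skeleton-path (e ∷ (f ∷ p)) = do
    s ← common-neighbour⇒skeleton-path e (Adj-sym f)
    ss ← even-walk⇒skeleton-path p
    pure (s ◅◅ ss)

  no-odd-closed-walk⇒bipartite : Connected Γ → ∀ u → ¬ Walk true u u → Bipartite Γ
  no-odd-closed-walk⇒bipartite (_ , connected) u noOdd = colour , proper
    where
    colour : Fin n → Bool
    colour x = proj₁ (star⇒walk (connected u x))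
    walk : ∀ x → Walk (colour x) u x
    walk x = proj₂ (star⇒walk (connected u x))
    proper : IsBipartition Γ colour
    proper x y xy same = noOdd (cast odd (walk x ++ reverse (walk y ++ (Adj-sym xy ∷ []))))
      where
      odd : colour x xor (colour y xor true) ≡ true
      odd = begin
        colour x xor (colour y xor true) ≡⟨ cong (_xor (colour y xor true)) same ⟩
        colour y xor (colour y xor true) ≡⟨ sym (xor-assoc (colour y) (colour y) true) ⟩
        (colour y xor colour y) xor true ≡⟨ cong (_xor true) (xor-same (colour y)) ⟩
        true                             ∎
        where open ≡-Reasoning

  nonbipartite⇒even-walks : Connected Γ → ¬ Bipartite Γ → ∀ u v → ¬ ¬ Walk false u v
  nonbipartite⇒even-walks Γ-connected nonbipartite u v noEven =
    nonbipartite (no-odd-closed-walk⇒bipartite Γ-connected u noOdd)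
    where
    noOdd : ¬ Walk true u u
    noOdd odd with star⇒walk (proj₂ Γ-connected u v)
    ... | false , even = noEven even
    ... | true , oddWalk = noEven (odd ++ oddWalk)

  skeleton-connected : Connected Γ → ¬ Bipartite Γ → ∀ u v → ¬ ¬ Star (SAdj Γ) u v
  skeleton-connected Γ-connected nonbipartite u v =
    nonbipartite⇒even-walks Γ-connected nonbipartite u v >>= even-walk⇒skeleton-path

module _ {A B : Set} (ρ : (A × B) ↔ (A × B)) (preservesFst : PreservesFst ρ) where
  open Inverse ρ using (to)

  fst-constant : ∀ a i j → proj₁ (to (a , i)) ≡ proj₁ (to (a , j))
  fst-constant a i j = let (_ , block) = preservesFst a in
    trans (proj₁ (block (a , i)) refl) (sym (proj₁ (block (a , j)) refl))

  fst-injective : ∀ {a b i j} → proj₁ (to (a , i)) ≡ proj₁ (to (b , j)) → a ≡ b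
  fst-injective {a} {b} {i} {j} eq = let (_ , block) = preservesFst a in
    sym (proj₂ (block (b , j)) (trans (sym eq) (proj₁ (block (a , i)) refl)))

  module _ {R : A → A → Set} {S : B → B → Set} (aut : IsAut (R □ S) ρ)
           (R-irreflexive : ∀ {a b} → R a b → a ≢ b) where

    edge-preserves-snd : ∀ {a b} → R a b → ∀ i → proj₂ (to (a , i)) ≡ proj₂ (to (b , i))
    edge-preserves-snd {a} {b} ab i with proj₁ (aut (a , i) (b , i)) (inj₂ (refl , ab))
    ... | inj₁ (same-fst , _) = contradiction (fst-injective same-fst) (R-irreflexive ab)
    ... | inj₂ (same-snd , _) = same-snd

    path-preserves-snd : ∀ {a b} → Star R a b → ∀ i → proj₂ (to (a , i)) ≡ proj₂ (to (b , i))
    path-preserves-snd ε i = refl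
    path-preserves-snd (ab ◅ path) i = trans (edge-preserves-snd ab i) (path-preserves-snd path i)

  snd-constant⇒preservesSnd :
    (∀ a b i → proj₂ (to (a , i)) ≡ proj₂ (to (b , i))) → A → PreservesSnd ρ
  snd-constant⇒preservesSnd snd-constant a₀ j =
    proj₂ (to (a₀ , j)) , λ (a , i) → (λ { refl → snd-constant a a₀ i }) , same-block
    where
    same-block : ∀ {a i} → proj₂ (to (a , i)) ≡ proj₂ (to (a₀ , j)) → i ≡ j
    same-block {a} {i} eq = cong proj₂ (Injection.injective (↔⇒↣ ρ)
      (×-≡,≡→≡ (fst-constant a i j , trans eq (snd-constant a₀ a j))))

lemma4p4 : {n m : ℕ} (Γ : Graph n) (Σ : Graph m) →
    Connected Γ → Connected Σ → ¬ Bipartite Γ →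
    (U : Fin m → Bool) → IsBipartition Σ U →
    (ρ : (Fin n × Fin m) ↔ (Fin n × Fin m)) →
    IsAut (SAdj Γ □ SAdj Σ) ρ →
    Stabilizes ρ (λ x → T (U (proj₂ x))) →
    SndMixer ρ →
    FstMixer ρ
lemma4p4 Γ _ Γ-connected _ nonbipartite _ _ ρ aut _ sndMixer preservesFst =
  sndMixer (snd-constant⇒preservesSnd ρ preservesFst snd-constant (fromℕ< (proj₁ Γ-connected)))
  where
  open Inverse ρ using (to)
  -- S(Γ) is connected only up to double negation, which is enough for an equation in Fin m.
  snd-constant : ∀ a b i → proj₂ (to (a , i)) ≡ proj₂ (to (b , i))
  snd-constant a b i = decidable-stable (proj₂ (to (a , i)) ≟ proj₂ (to (b , i)))
    (¬¬-map (λ path → path-preserves-snd ρ preservesFst aut (proj₁ ∘ proj₁) path i)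
            (skeleton-connected Γ Γ-connected nonbipartite a b))
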